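{- Let $\mathcal{S}=\langle\mathbf{Fm},\vdash\rangle$ be a Hilbert-style logic with axioms $A$ and rules $R_\mathcal{S}$, let $\mathcal{S}^l=\langle\mathbf{Fm},\vdash^l\rangle$ be its left variable inclusion companion and $\mathcal{S}^{re}=\langle\mathbf{Fm},\vdash^{re}\rangle$ its restricted rules companion. Then for all $\Sigma\cup\{\varphi\}\subseteq\mathit{Fm}$, if $\Sigma\vdash^{re}\varphi$ then $\Sigma\vdash^l\varphi$; that is, $\vdash^{re}\subseteq\vdash^l$.
   Context: $\mathbf{Fm}$ is the formula algebra of a logical language $\mathcal{L}$ (connectives of finite arity) over a countably infinite set $V$ of variables, universe $\mathit{Fm}$. A Hilbert-style logic is given by schematic (substitution-closed) sets of axioms $A\subseteq\mathit{Fm}$ and rules $R\subseteq\mathcal{P}(\mathit{Fm})\times\mathit{Fm}$ (written $\frac{\Gamma}{\alpha}$); $\Sigma\vdash\varphi$ iff there is a finite sequence ending in $\varphi$ each member of which is an axiom, a member of $\Sigma$, or obtained from earlier members by a rule. $\mathrm{var}(\varphi)$ is the set of variables of $\varphi$, $\mathrm{var}(\Gamma)=\bigcup_{\gamma\in\Gamma}\mathrm{var}(\gamma)$. Left variable inclusion companion: $\Gamma\vdash^l\varphi$ iff there is $\Gamma'\subseteq\Gamma$ with $\mathrm{var}(\Gamma')\subseteq\mathrm{var}(\varphi)$ and $\Gamma'\vdash\varphi$. Restricted rules companion $\mathcal{S}^{re}$: the Hilbert-style logic with the same axioms $A$ and rules $\{\frac{\Gamma}{\alpha}\in R_\mathcal{S}\mid\mathrm{var}(\Gamma)\subseteq\mathrm{var}(\alpha)\}$.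 -}

module Defs where

open import Level using (Level; suc; zero)
open import Data.Nat using (ℕ)
open import Data.Fin using (Fin)
open import Data.Product using (Σ; ∃; _×_; _,_)
open import Data.Sum using (_⊎_)
open import Data.List using (List; _∷_)
open import Data.List.Membership.Propositional using (_∈_)
open import Relation.Binary.PropositionalEquality using (_≡_)

record Language : Set₁ where
  field
    Op    : Set
    arity : Op → ℕ

module _ (L : Language) where
  open Language L

  data Fm : Set where
    var : ℕ → Fm
    op  : (o : Op) → (Fin (arity o) → Fm) → Fm

  data Occurs (x : ℕ) : Fm → Set where
    here  : Occurs x (var x)
    under : ∀ {o} {args : Fin (arity o) → Fm} (i : Fin (arity o)) →
            Occurs x (args i) → Occurs x (op o args)

  FmSet : Set₁
  FmSet = Fm → Set

  VarsIn : FmSet → Fm → Set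
  VarsIn Γ α = ∀ γ x → Γ γ → Occurs x γ → Occurs x α

  _⊆_ : FmSet → FmSet → Set
  Γ ⊆ Δ = ∀ ψ → Γ ψ → Δ ψ

  Subst : Set
  Subst = ℕ → Fm

  sub : Subst → Fm → Fm
  sub σ (var x)     = σ x
  sub σ (op o args) = op o (λ i → sub σ (args i))

  image : Subst → FmSet → FmSet
  image σ Γ ψ = Σ Fm λ γ → Γ γ × sub σ γ ≡ ψ

  Rules : Set₁
  Rules = FmSet → Fm → Set

  SchematicAxioms : FmSet → Set
  SchematicAxioms A = ∀ σ φ → A φ → A (sub σ φ)

  SchematicRules : Rules → Set₁
  SchematicRules R = ∀ σ Γ α → R Γ α → R (image σ Γ) (sub σ α)

  -- A derivation is a finite sequence, stored in
  -- reverse (the most recent member first); each member is an axiom, a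
  -- member of Σ, or follows by a rule from earlier members.
  data Deriv (A : FmSet) (R : Rules) (Σs : FmSet) : List Fm → Set₁ where
    []ᵈ   : Deriv A R Σs Data.List.[]
    axᵈ   : ∀ {l φ} → Deriv A R Σs l → A φ → Deriv A R Σs (φ ∷ l)
    hypᵈ  : ∀ {l φ} → Deriv A R Σs l → Σs φ → Deriv A R Σs (φ ∷ l)
    ruleᵈ : ∀ {l φ} → Deriv A R Σs l → (Γ : FmSet) → R Γ φ →
            (∀ γ → Γ γ → γ ∈ l) → Deriv A R Σs (φ ∷ l)

  Derives : FmSet → Rules → FmSet → Fm → Set₁
  Derives A R Σs φ = ∃ λ l → Deriv A R Σs (φ ∷ l)

  DerivesL : FmSet → Rules → FmSet → Fm → Set₁
  DerivesL A R Σs φ = Σ FmSet λ Γ' → Γ' ⊆ Σs × VarsIn Γ' φ × Derives A R Γ' φ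

  restrict : Rules → Rules
  restrict R Γ α = R Γ α × VarsIn Γ α

  DerivesRe : FmSet → Rules → FmSet → Fm → Set₁
  DerivesRe A R = Derives A (restrict R)

module Submission where

open import Defs
open import Data.Nat using (_≟_)
open import Data.Fin.Properties using (any?; all?)
open import Data.Product using (Σ; _×_; _,_; proj₁; proj₂)
open import Data.List using (List; _∷_; [])
open import Data.List.Membership.Propositional using (_∈_)
open import Data.List.Relation.Unary.Any using (here; there)
open import Relation.Nullary using (Dec; yes; no; contradiction)
open import Relation.Binary.PropositionalEquality using (refl)

-- A restricted-rules derivation is pruned to the members whose variables
-- occur in φ.  This set is closed backwards under restricted rules (their
-- premises use only variables of the conclusion), and the hypotheses it
-- keeps are exactly the Γ' ⊆ Σ required for ⊢ˡ.

module _ {L : Language} where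

  VarsWithin : Fm L → Fm L → Set
  VarsWithin ψ φ = ∀ x → Occurs L x ψ → Occurs L x φ

  occurs? : ∀ x ψ → Dec (Occurs L x ψ)
  occurs? x (var y) with x ≟ y
  ... | yes refl = yes here
  ... | no x≢y   = no λ { here → x≢y refl }
  occurs? x (op o args) with any? (λ i → occurs? x (args i))
  ... | yes (i , p) = yes (under i p)
  ... | no ¬p       = no λ { (under i p) → ¬p (i , p) }

  varsWithin? : ∀ ψ φ → Dec (VarsWithin ψ φ)
  varsWithin? (var y) φ with occurs? y φ
  ... | yes p = yes λ { _ here → p }
  ... | no ¬p = no λ w → ¬p (w y here)
  varsWithin? (op o args) φ with all? (λ i → varsWithin? (args i) φ)
  ... | yes p = yes λ { x (under i q) → p i x q }
  ... | no ¬p = no λ w → ¬p (λ i x q → w x (under i q))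

  restrict-varsWithin : ∀ {φ R Γ α} → restrict L R Γ α →
                        VarsWithin α φ → ∀ γ → Γ γ → VarsWithin γ φ
  restrict-varsWithin (_ , Γ⊑α) α⊑φ γ γ∈Γ x x∈γ = α⊑φ x (Γ⊑α γ x γ∈Γ x∈γ)

  _∩_ : FmSet L → (Fm L → Set) → FmSet L
  (Σs ∩ P) γ = Σs γ × P γ

  module _ {A : FmSet L} {R : Rules L} {Σs : FmSet L} where

    Deriv-tail : ∀ {ψ l} → Deriv L A R Σs (ψ ∷ l) → Deriv L A R Σs l
    Deriv-tail (axᵈ d _)       = d
    Deriv-tail (hypᵈ d _)      = d
    Deriv-tail (ruleᵈ d _ _ _) = d

    Deriv-∈⇒Derives : ∀ {ψ l} → Deriv L A R Σs l → ψ ∈ l → Derives L A R Σs ψ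
    Deriv-∈⇒Derives {l = _ ∷ l} d (here refl) = l , d
    Deriv-∈⇒Derives d (there ψ∈l)              = Deriv-∈⇒Derives (Deriv-tail d) ψ∈l

    Deriv-mapRules : ∀ {R′ : Rules L} → (∀ {Γ α} → R Γ α → R′ Γ α) →
                     ∀ {l} → Deriv L A R Σs l → Deriv L A R′ Σs l
    Deriv-mapRules f []ᵈ                 = []ᵈ
    Deriv-mapRules f (axᵈ d a)           = axᵈ (Deriv-mapRules f d) a
    Deriv-mapRules f (hypᵈ d h)          = hypᵈ (Deriv-mapRules f d) h
    Deriv-mapRules f (ruleᵈ d Γ r Γ⊆l)   = ruleᵈ (Deriv-mapRules f d) Γ (f r) Γ⊆l

    module _ {P : Fm L → Set} (P? : ∀ ψ → Dec (P ψ))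
             (P-backward : ∀ {Γ α} → R Γ α → P α → ∀ γ → Γ γ → P γ) where

      Pruned : List (Fm L) → Set₁
      Pruned l = Σ (List (Fm L)) λ l′ →
                 Deriv L A R (Σs ∩ P) l′ × (∀ ψ → ψ ∈ l → P ψ → ψ ∈ l′)

      prune : ∀ {l} → Deriv L A R Σs l → Pruned l
      prune []ᵈ = [] , []ᵈ , λ _ ()
      prune {ψ ∷ l} d with P? ψ | prune (Deriv-tail d)
      ... | no ¬Pψ | l′ , d′ , keep =
        l′ , d′ , λ { _ (here refl) Pψ → contradiction Pψ ¬Pψ
                    ; χ (there χ∈l) → keep χ χ∈l }
      ... | yes Pψ | l′ , d′ , keep =
        ψ ∷ l′ , extend d , λ { _ (here refl) _ → here refl
                              ; χ (there χ∈l) Pχ → there (keep χ χ∈l Pχ) }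
        where
          extend : Deriv L A R Σs (ψ ∷ l) → Deriv L A R (Σs ∩ P) (ψ ∷ l′)
          extend (axᵈ _ a)          = axᵈ d′ a
          extend (hypᵈ _ h)         = hypᵈ d′ (h , Pψ)
          extend (ruleᵈ _ Γ r Γ⊆l) =
            ruleᵈ d′ Γ r λ γ γ∈Γ → keep γ (Γ⊆l γ γ∈Γ) (P-backward r Pψ γ γ∈Γ)

theorem3p6 : (L : Language) (A : FmSet L) (R : Rules L) →
    SchematicAxioms L A → SchematicRules L R →
    (Σs : FmSet L) (φ : Fm L) →
    DerivesRe L A R Σs φ → DerivesL L A R Σs φ
theorem3p6 L A R _ _ Σs φ (l , d)
  with prune (λ ψ → varsWithin? ψ φ) (restrict-varsWithin {φ = φ} {R = R}) d
... | l′ , d′ , keep =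
  Σs ∩ (λ γ → VarsWithin γ φ) , (λ _ → proj₁) , (λ γ x γ∈Γ′ → proj₂ γ∈Γ′ x) ,
  Deriv-∈⇒Derives (Deriv-mapRules proj₁ d′) (keep φ (here refl) λ _ x∈φ → x∈φ)
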